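{- Let $T$ be a tree and $v$ a vertex of $T$. Let $U_1$ be the vertex set of a component of $T-v$ and let $U_2=V(T-v)\setminus U_1$. Suppose that for $i=1,2$, $G_i=T[U_i\cup\{v\}]$ admits a $3$-rs colouring $f_i$ with $f_i(v)=0$. Then the function $f$ on $V(T)$ defined by $f(w)=f_i(w)$ for all $w\in V(G_i)$, $i=1,2$, is a $3$-rs colouring of $T$.
   Context: A $3$-restricted star colouring ($3$-rs colouring) of a graph $G$ is a map $f:V(G)\to\{0,1,2\}$ with $f(x)\neq f(y)$ for every edge $xy$ and with no path $x,y,z$ in $G$ such that $f(y)>f(x)=f(z)$. $T[S]$ denotes the subgraph of $T$ induced by $S$. -}

module Defs where

open import Data.Nat using (ℕ; _≤_; _<_)
open import Data.Fin using (Fin; toℕ)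
open import Data.List using (List; []; _∷_; _++_; length)
open import Data.List.Relation.Unary.Linked using (Linked)
open import Data.List.Relation.Unary.Unique.Propositional using (Unique)
open import Data.Product using (Σ; Σ-syntax; ∃; _×_; _,_)
open import Data.Sum using (_⊎_)
open import Data.Empty using (⊥)
open import Relation.Nullary using (¬_)
open import Relation.Binary.PropositionalEquality using (_≡_; _≢_)

record Graph (n : ℕ) : Set₁ where
  field
    Adj    : Fin n → Fin n → Set
    sym    : ∀ {x y} → Adj x y → Adj y x
    irrefl : ∀ {x} → ¬ Adj x x
open Graph public

data Reach {V : Set} (R : V → V → Set) : V → V → Set where
  here : ∀ {x} → Reach R x x
  step : ∀ {x y z} → R x y → Reach R y z → Reach R x z

Connected : ∀ {n} → Graph n → Set
Connected G = ∀ u w → Reach (Adj G) u w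

-- A cycle: distinct vertices x ∷ ys (at least 3 of them), consecutive ones
-- adjacent, and the last one adjacent to x.
HasCycle : ∀ {n} → Graph n → Set
HasCycle {n} G = Σ (Fin n) λ x → Σ (List (Fin n)) λ ys →
  (2 ≤ length ys) × Unique (x ∷ ys) × Linked (Adj G) (x ∷ ys ++ (x ∷ []))

IsTree : ∀ {n} → Graph n → Set
IsTree G = Connected G × ¬ HasCycle G

VMinus : ∀ {n} → Fin n → Set
VMinus {n} v = Σ (Fin n) λ w → w ≢ v

AdjMinus : ∀ {n} (G : Graph n) (v : Fin n) → VMinus v → VMinus v → Set
AdjMinus G v (a , _) (b , _) = Adj G a b

IsComponentMinus : ∀ {n} (G : Graph n) (v : Fin n) → (Fin n → Set) → Set
IsComponentMinus {n} G v U = Σ (VMinus v) λ u → ∀ w →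
  (U w → Σ (w ≢ v) λ p → Reach (AdjMinus G v) u (w , p)) ×
  (Σ (w ≢ v) (λ p → Reach (AdjMinus G v) u (w , p)) → U w)

Is3RS : {V : Set} → (V → V → Set) → (V → Fin 3) → Set
Is3RS {V} R f =
  (∀ x y → R x y → f x ≢ f y) ×
  (∀ x y z → R x y → R y z → x ≢ z →
     ¬ (toℕ (f x) < toℕ (f y) × f x ≡ f z))

VSub : ∀ {n} → (Fin n → Set) → Set
VSub {n} S = Σ (Fin n) S

AdjSub : ∀ {n} (G : Graph n) (S : Fin n → Set) → VSub S → VSub S → Set
AdjSub G S (a , _) (b , _) = Adj G a b

WithV : ∀ {n} → (Fin n → Set) → Fin n → Fin n → Set
WithV U v w = U w ⊎ w ≡ v

ComplMinus : ∀ {n} → (Fin n → Set) → Fin n → Fin n → Set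
ComplMinus U₁ v w = (w ≢ v) × ¬ U₁ w

{-# OPTIONS --safe #-}
-- No edge of T joins U₁ to U₂, so every vertex y ≠ v has its closed
-- neighbourhood inside G₁ or inside G₂; hence every edge and every path x,y,z
-- with middle vertex y ≠ v is checked by f₁ or by f₂.  A path x,v,z is harmless
-- because f(v) = 0 cannot exceed f(x).
module Submission where

open import Defs
open import Data.Nat using (_<_)
open import Data.Nat.Properties using (n≮0)
open import Data.Fin using (Fin; zero; toℕ; _≟_)
open import Data.Product using (_×_; _,_; proj₁; proj₂)
open import Data.Sum using (_⊎_; inj₁; inj₂)
open import Relation.Nullary using (¬_; yes; no)
open import Relation.Nullary.Decidable.Core using (¬¬-excluded-middle)
open import Relation.Binary.PropositionalEquality
  using (_≡_; _≢_; refl; trans; subst; subst₂; cong) renaming (sym to ≡-sym)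

Reach-snoc : ∀ {V : Set} {R : V → V → Set} {a b c} → Reach R a b → R b c → Reach R a c
Reach-snoc here r = step r here
Reach-snoc (step r′ p) r = step r′ (Reach-snoc p r)

ClosedNbhdWithin : ∀ {n} → Graph n → (Fin n → Set) → Fin n → Set
ClosedNbhdWithin G S y = S y × (∀ {x} → Adj G y x → S x)

closedNbhdWithin-WithV : ∀ {n} (G : Graph n) {U : Fin n → Set} {v y : Fin n} →
  U y → (∀ {x} → Adj G y x → x ≢ v → U x) → ClosedNbhdWithin G (WithV U v) y
closedNbhdWithin-WithV G {U} {v} {y} uy closed = inj₁ uy , nbhd
  where
  nbhd : ∀ {x} → Adj G y x → WithV U v x
  nbhd {x} a with x ≟ v
  ... | yes x≡v = inj₂ x≡v
  ... | no  x≢v = inj₁ (closed a x≢v)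

module Restriction {n} (G : Graph n) {S : Fin n → Set} {g : VSub S → Fin 3}
  (g-rs : Is3RS (AdjSub G S) g) {f : Fin n → Fin 3} (f≡g : ∀ w p → f w ≡ g (w , p)) where

  proper-at : ∀ {x y} → ClosedNbhdWithin G S y → Adj G y x → f y ≢ f x
  proper-at {x} {y} (sy , nbhd) a fy≡fx =
    proj₁ g-rs (y , sy) (x , nbhd a) a
      (trans (≡-sym (f≡g y sy)) (trans fy≡fx (f≡g x (nbhd a))))

  star-at : ∀ {x y z} → ClosedNbhdWithin G S y → Adj G x y → Adj G y z → x ≢ z →
    ¬ (toℕ (f x) < toℕ (f y) × f x ≡ f z)
  star-at {x} {y} {z} (sy , nbhd) xy yz x≢z (lt , fx≡fz) =
    proj₂ g-rs (x , px) (y , sy) (z , pz) xy yz (λ e → x≢z (cong proj₁ e))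
      ( subst₂ (λ c d → toℕ c < toℕ d) (f≡g x px) (f≡g y sy) lt
      , trans (≡-sym (f≡g x px)) (trans fx≡fz (f≡g z pz)) )
    where
    px = nbhd (Graph.sym G xy)
    pz = nbhd yz

module Split {n} (T : Graph n) (v : Fin n) (U₁ : Fin n → Set)
  (component : IsComponentMinus T v U₁) where

  U₂ = ComplMinus U₁ v

  U₁-closed : ∀ {y x} → U₁ y → Adj T y x → x ≢ v → U₁ x
  U₁-closed {y} {x} uy a x≢v =
    proj₂ (proj₂ component x)
      (x≢v , Reach-snoc (proj₂ (proj₁ (proj₂ component y) uy)) a)

  U₂-closed : ∀ {y x} → U₂ y → Adj T y x → x ≢ v → U₂ x
  U₂-closed (y≢v , ¬uy) a x≢v = x≢v , λ ux → ¬uy (U₁-closed ux (Graph.sym T a) y≢v)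

  closedNbhd-side : ∀ {y} → y ≢ v →
    ¬ ¬ (ClosedNbhdWithin T (WithV U₁ v) y ⊎ ClosedNbhdWithin T (WithV U₂ v) y)
  closedNbhd-side {y} y≢v k = ¬¬-excluded-middle λ
    { (yes uy) → k (inj₁ (closedNbhdWithin-WithV T uy (U₁-closed uy)))
    ; (no ¬uy) → k (inj₂ (closedNbhdWithin-WithV T (y≢v , ¬uy) (U₂-closed (y≢v , ¬uy)))) }

lemma3 : ∀ {n} (T : Graph n) → IsTree T → (v : Fin n) → (U₁ : Fin n → Set) →
    IsComponentMinus T v U₁ →
    (f₁ : VSub (WithV U₁ v) → Fin 3) → (f₂ : VSub (WithV (ComplMinus U₁ v) v) → Fin 3) →
    Is3RS (AdjSub T (WithV U₁ v)) f₁ → Is3RS (AdjSub T (WithV (ComplMinus U₁ v) v)) f₂ →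
    (∀ p → f₁ (v , p) ≡ zero) → (∀ p → f₂ (v , p) ≡ zero) →
    (f : Fin n → Fin 3) →
    (∀ w p → f w ≡ f₁ (w , p)) → (∀ w p → f w ≡ f₂ (w , p)) →
    Is3RS (Adj T) f
lemma3 T _ v U₁ component f₁ f₂ rs₁ rs₂ f₁v≡0 _ f f≡f₁ f≡f₂ = proper , star
  where
  open Split T v U₁ component

  fv≡0 : f v ≡ zero
  fv≡0 = trans (f≡f₁ v (inj₂ refl)) (f₁v≡0 (inj₂ refl))

  module R₁ = Restriction T rs₁ f≡f₁
  module R₂ = Restriction T rs₂ f≡f₂

  proper-at : ∀ {x y} → y ≢ v → Adj T y x → f y ≢ f x
  proper-at y≢v a fy≡fx = closedNbhd-side y≢v λ
    { (inj₁ N₁) → R₁.proper-at N₁ a fy≡fx ; (inj₂ N₂) → R₂.proper-at N₂ a fy≡fx }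

  proper : ∀ x y → Adj T x y → f x ≢ f y
  proper x y a with x ≟ v
  ... | no  x≢v = proper-at x≢v a
  ... | yes refl = λ fx≡fy → proper-at (λ { refl → Graph.irrefl T a }) (Graph.sym T a) (≡-sym fx≡fy)

  star : ∀ x y z → Adj T x y → Adj T y z → x ≢ z → ¬ (toℕ (f x) < toℕ (f y) × f x ≡ f z)
  star x y z xy yz x≢z (lt , fx≡fz) with y ≟ v
  ... | yes refl = n≮0 (subst (λ c → toℕ (f x) < toℕ c) fv≡0 lt)
  ... | no  y≢v = closedNbhd-side y≢v λ
    { (inj₁ N₁) → R₁.star-at N₁ xy yz x≢z (lt , fx≡fz)
    ; (inj₂ N₂) → R₂.star-at N₂ xy yz x≢z (lt , fx≡fz) }
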